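{- Let $a,b$ be positive integers such that exactly one of them is odd, and put $k=a^2+b^2$. For a positive integer $\Delta$ put $$c=\frac{k-\Delta^2}{2\Delta},\qquad d=c+\Delta .$$ Then $c,d$ are positive integers and $(a,b,c,d)$ is a primitive Pythagorean quadruple if and only if all of the following hold: (1) $\Delta$ divides $k$; (2) $\Delta^2<k$; (3) for every prime $p$ dividing $\gcd(a,b)$, the exponent of $p$ in $\Delta$ is either $0$ or equal to the exponent of $p$ in $k$. Moreover, every primitive Pythagorean quadruple with first two entries $a,b$ arises in this way, with $\Delta=d-c$.
   Context: A Pythagorean quadruple is an ordered quadruple $(a,b,c,d)$ of positive integers with $a^2+b^2+c^2=d^2$. It is primitive if $\gcd(a,b,c,d)=1$. For a prime $p$ and a positive integer $x$, the exponent of $p$ in $x$ is the largest $e\ge 0$ with $p^e\mid x$. -}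

module Defs where

open import Data.Nat using (ℕ; zero; suc; _+_; _*_; _∸_; _^_; _≤_; _<_)
open import Data.Nat.Divisibility using (_∣_)
open import Data.Nat.GCD using (gcd)
open import Data.Nat.Primality using (Prime)
open import Data.Product using (_×_)
open import Data.Sum using (_⊎_)
open import Relation.Binary.PropositionalEquality using (_≡_)
open import Relation.Nullary using (¬_)

ExactlyOneOdd : ℕ → ℕ → Set
ExactlyOneOdd a b = (¬ (2 ∣ a) × 2 ∣ b) ⊎ (2 ∣ a × ¬ (2 ∣ b))

IsPythQuad : ℕ → ℕ → ℕ → ℕ → Set
IsPythQuad a b c d =
  0 < a × 0 < b × 0 < c × 0 < d × a ^ 2 + b ^ 2 + c ^ 2 ≡ d ^ 2

IsPrimitivePythQuad : ℕ → ℕ → ℕ → ℕ → Set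
IsPrimitivePythQuad a b c d =
  IsPythQuad a b c d × gcd (gcd (gcd a b) c) d ≡ 1

IsExponent : ℕ → ℕ → ℕ → Set
IsExponent p x e = (p ^ e ∣ x) × (∀ e′ → p ^ e′ ∣ x → e′ ≤ e)

Cond3 : ℕ → ℕ → ℕ → ℕ → Set
Cond3 a b Δ k = ∀ p → Prime p → p ∣ gcd a b →
  ∀ e f → IsExponent p Δ e → IsExponent p k f → (e ≡ 0 ⊎ e ≡ f)

{-# OPTIONS --safe #-}
-- With d = c + Δ the equation a² + b² + c² = d² says exactly k = Δ(2c + Δ). As k is odd, a divisor
-- Δ of k with Δ² < k has an odd cofactor k/Δ > Δ, so k/Δ = 2c + Δ for a unique positive c. A prime
-- p dividing gcd(a,b,c,d) divides gcd(a,b), Δ and 2c + Δ; conversely, if p ∣ gcd(a,b) divides Δ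
-- and 2c + Δ, then p is odd and divides 2c, hence c and d. So primitivity means that no prime of
-- gcd(a,b) divides both Δ and k/Δ, which in terms of p-adic exponents is condition (3).
module Submission where

open import Defs
open import Data.Nat.Base
  using (ℕ; zero; suc; _+_; _*_; _∸_; _^_; _<_; _≤_; z≤n; s≤s; z<s; NonZero; >-nonZero;
         nonTrivial⇒n>1)
open import Data.Nat.Properties
open import Data.Nat.Divisibility
open import Data.Nat.GCD using (gcd; gcd-greatest; gcd[m,n]∣m; gcd[m,n]∣n)
open import Data.Nat.Primality
  using (Prime; euclidsLemma; prime⇒irreducible; prime⇒nonZero; prime⇒nonTrivial; prime[2])
open import Data.Nat.Primality.Factorisation using (factorise)
open import Data.Nat.Coprimality using (Coprime; coprime-divisor)
open import Data.Nat.Induction using (<-rec)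
open import Data.Nat.ListAction using (product)
open import Data.Nat.Solver using (module +-*-Solver)
open import Data.List.Base using ([]; _∷_)
open import Data.List.Relation.Unary.All using (_∷_)
open import Data.Product using (_×_; Σ; _,_; proj₁; ∃; ∃-syntax)
open import Data.Sum using (inj₁; inj₂)
open import Data.Empty using (⊥-elim)
open import Function.Base using (_∘_)
open import Function.Bundles using (_⇔_; mk⇔)
open import Relation.Binary.PropositionalEquality
open import Relation.Nullary using (¬_; yes; no)

open +-*-Solver using (solve; _:+_; _:*_; _:^_; _:=_; con)
open ≡-Reasoning

private
  variable
    a b c d k m n p x e f Δ : ℕ

prime∤1 : Prime p → ¬ p ∣ 1
prime∤1 {p} pp p∣1 = <-irrefl (sym (∣1⇒≡1 p∣1)) (nonTrivial⇒n>1 p {{prime⇒nonTrivial pp}})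

∃-prime-divisor : 1 < n → ∃[ p ] Prime p × p ∣ n
∃-prime-divisor {n} 1<n with factorise n {{>-nonZero (<-trans z<s 1<n)}}
... | record { factors = [] ; isFactorisation = n≡1 } = ⊥-elim (<-irrefl (sym n≡1) 1<n)
... | record { factors = q ∷ qs ; isFactorisation = n≡q*qs ; factorsPrime = prime-q ∷ _ } =
  q , prime-q , subst (q ∣_) (sym n≡q*qs) (m∣m*n (product qs))

prime∣prime⇒≡ : Prime p → Prime m → p ∣ m → p ≡ m
prime∣prime⇒≡ {p} pp pm p∣m with prime⇒irreducible pm p∣m
... | inj₁ p≡1 = ⊥-elim (prime∤1 pp (subst (p ∣_) p≡1 ∣-refl))
... | inj₂ p≡m = p≡m

prime∣m^n⇒∣m : Prime p → ∀ n → p ∣ m ^ n → p ∣ m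
prime∣m^n⇒∣m pp zero p∣1 = ⊥-elim (prime∤1 pp p∣1)
prime∣m^n⇒∣m {m = m} pp (suc n) p∣mⁿ⁺¹ with euclidsLemma m (m ^ n) pp p∣mⁿ⁺¹
... | inj₁ p∣m = p∣m
... | inj₂ p∣mⁿ = prime∣m^n⇒∣m pp n p∣mⁿ

no-prime-divisor⇒≡1 : n ≢ 0 → (∀ {p} → Prime p → ¬ p ∣ n) → n ≡ 1
no-prime-divisor⇒≡1 {zero} n≢0 _ = ⊥-elim (n≢0 refl)
no-prime-divisor⇒≡1 {suc zero} _ _ = refl
no-prime-divisor⇒≡1 {suc (suc n)} _ no-prime with ∃-prime-divisor (s≤s (s≤s (z≤n {n})))
... | p , pp , p∣n = ⊥-elim (no-prime pp p∣n)

prime^n-coprime : Prime p → ¬ p ∣ m → ∀ n → Coprime (p ^ n) m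
prime^n-coprime {p} {m} pp p∤m n {i} (i∣pⁿ , i∣m) = no-prime-divisor⇒≡1 i≢0 no-prime
  where
  i≢0 : i ≢ 0
  i≢0 i≡0 = p∤m (subst (p ∣_) (sym (0∣⇒≡0 (subst (_∣ m) i≡0 i∣m))) (p ∣0))
  no-prime : ∀ {q} → Prime q → ¬ q ∣ i
  no-prime pq q∣i with prime∣prime⇒≡ pq pp (prime∣m^n⇒∣m pq n (∣-trans q∣i i∣pⁿ))
  ... | refl = p∤m (∣-trans q∣i i∣m)

exponent-unique : IsExponent p x e → IsExponent p x f → e ≡ f
exponent-unique (pᵉ∣x , e-max) (pᶠ∣x , f-max) = ≤-antisym (f-max _ pᵉ∣x) (e-max _ pᶠ∣x)

exponent-of-non-divisor : ¬ p ∣ x → IsExponent p x 0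
exponent-of-non-divisor {p} {x} p∤x = 1∣ x , maximal
  where
  maximal : ∀ e → p ^ e ∣ x → e ≤ 0
  maximal zero _ = z≤n
  maximal (suc e) pᵉ⁺¹∣x = ⊥-elim (p∤x (∣-trans (m∣m*n (p ^ e)) pᵉ⁺¹∣x))

exponent-of-multiple : .{{NonZero p}} → IsExponent p x e → IsExponent p (p * x) (suc e)
exponent-of-multiple {p} {x} {e} (pᵉ∣x , e-max) = *-monoʳ-∣ p pᵉ∣x , maximal
  where
  maximal : ∀ e′ → p ^ e′ ∣ p * x → e′ ≤ suc e
  maximal zero _ = z≤n
  maximal (suc e′) pᵉ′⁺¹∣px = s≤s (e-max e′ (*-cancelˡ-∣ p pᵉ′⁺¹∣px))

exponent-exists : Prime p → 0 < x → ∃ (IsExponent p x)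
exponent-exists {p} pp = <-rec (λ x → 0 < x → ∃ (IsExponent p x)) step _
  where
  instance
    p≢0 : NonZero p
    p≢0 = prime⇒nonZero pp
  step : ∀ x → (∀ {y} → y < x → 0 < y → ∃ (IsExponent p y)) → 0 < x → ∃ (IsExponent p x)
  step x rec 0<x with p ∣? x
  ... | no p∤x = 0 , exponent-of-non-divisor p∤x
  ... | yes (divides y refl) =
    let e , y-exp = rec y<x 0<y
    in suc e , subst (λ z → IsExponent p z (suc e)) (*-comm p y) (exponent-of-multiple y-exp)
    where
    0<y : 0 < y
    0<y = *-cancelʳ-< p 0 y 0<x
    y<x : y < y * p
    y<x = m<m*n y p {{>-nonZero 0<y}} (nonTrivial⇒n>1 p {{prime⇒nonTrivial pp}})

0<exponent-of-divisor : p ∣ x → IsExponent p x e → 0 < e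
0<exponent-of-divisor {p} p∣x (_ , e-max) = e-max 1 (subst (_∣ _) (sym (*-identityʳ p)) p∣x)

exponent-*-coprime : Prime p → ¬ p ∣ m → IsExponent p x e → IsExponent p (x * m) f → e ≡ f
exponent-*-coprime {p} {m} {x} {f = f} pp p∤m (pᵉ∣x , e-max) (pᶠ∣xm , f-max) =
  ≤-antisym (f-max _ (∣m⇒∣m*n m pᵉ∣x)) (e-max f pᶠ∣x)
  where
  pᶠ∣x : p ^ f ∣ x
  pᶠ∣x = coprime-divisor (prime^n-coprime pp p∤m f) (subst (p ^ f ∣_) (*-comm x m) pᶠ∣xm)

exponent-*-divisor : p ∣ m → IsExponent p x e → IsExponent p (x * m) f → e < f
exponent-*-divisor {p} {m} {x} {e} p∣m (pᵉ∣x , _) (_ , f-max) =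
  f-max (suc e) (subst (_∣ x * m) (*-comm (p ^ e) p) (*-pres-∣ pᵉ∣x p∣m))

CoprimeAtPrimesOf : ℕ → ℕ → ℕ → Set
CoprimeAtPrimesOf g m n = ∀ {p} → Prime p → p ∣ g → p ∣ m → ¬ p ∣ n

coprime-at-primes⇒cond3 : CoprimeAtPrimesOf (gcd a b) Δ m → Cond3 a b Δ (Δ * m)
coprime-at-primes⇒cond3 {Δ = Δ} coprime p pp p∣g e f Δ-exp k-exp with p ∣? Δ
... | no p∤Δ = inj₁ (exponent-unique Δ-exp (exponent-of-non-divisor p∤Δ))
... | yes p∣Δ = inj₂ (exponent-*-coprime pp (coprime pp p∣g p∣Δ) Δ-exp k-exp)

cond3⇒coprime-at-primes : 0 < Δ → 0 < m → Cond3 a b Δ (Δ * m) → CoprimeAtPrimesOf (gcd a b) Δ m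
cond3⇒coprime-at-primes {Δ} {m} 0<Δ 0<m cond3 pp p∣g p∣Δ p∣m
  with exponent-exists pp 0<Δ | exponent-exists pp (*-mono-< 0<Δ 0<m)
... | e , Δ-exp | f , k-exp with cond3 _ pp p∣g e f Δ-exp k-exp
...   | inj₁ e≡0 = <-irrefl (sym e≡0) (0<exponent-of-divisor p∣Δ Δ-exp)
...   | inj₂ e≡f = <-irrefl e≡f (exponent-*-divisor p∣m Δ-exp k-exp)

odd⇒1+u*2 : ¬ 2 ∣ n → ∃[ u ] n ≡ 1 + u * 2
odd⇒1+u*2 {zero} 2∤0 = ⊥-elim (2∤0 (2 ∣0))
odd⇒1+u*2 {suc zero} _ = 0 , refl
odd⇒1+u*2 {suc (suc n)} 2∤n+2 =
  let u , n≡1+u*2 = odd⇒1+u*2 (2∤n+2 ∘ ∣m∣n⇒∣m+n ∣-refl) in suc u , cong (2 +_) n≡1+u*2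

odd+odd-even : ¬ 2 ∣ m → ¬ 2 ∣ n → 2 ∣ m + n
odd+odd-even 2∤m 2∤n with odd⇒1+u*2 2∤m | odd⇒1+u*2 2∤n
... | u , refl | v , refl =
  divides (1 + u + v)
    (solve 2 (λ u v → con 1 :+ u :* con 2 :+ (con 1 :+ v :* con 2) := (con 1 :+ u :+ v) :* con 2) refl u v)

odd-gap : ¬ 2 ∣ m → ¬ 2 ∣ n → m < n → ∃[ c ] 0 < c × n ≡ 2 * c + m
odd-gap {m} {n} 2∤m 2∤n m<n with 2 ∣? (n ∸ m)
... | no 2∤n∸m = ⊥-elim (2∤n (subst (2 ∣_) (m+[n∸m]≡n (<⇒≤ m<n)) (odd+odd-even 2∤m 2∤n∸m)))
... | yes (divides c n∸m≡c*2) = c , 0<c , n≡2c+m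
  where
  0<c : 0 < c
  0<c = *-cancelʳ-< 2 0 c (subst (0 <_) n∸m≡c*2 (m<n⇒0<n∸m m<n))
  n≡2c+m : n ≡ 2 * c + m
  n≡2c+m = begin
    n             ≡⟨ m∸n+n≡m (<⇒≤ m<n) ⟨
    (n ∸ m) + m   ≡⟨ cong (_+ m) (trans n∸m≡c*2 (*-comm c 2)) ⟩
    2 * c + m     ∎

exactlyOneOdd⇒¬2∣gcd : ExactlyOneOdd a b → ¬ 2 ∣ gcd a b
exactlyOneOdd⇒¬2∣gcd {a} {b} (inj₁ (2∤a , _)) 2∣g = 2∤a (∣-trans 2∣g (gcd[m,n]∣m a b))
exactlyOneOdd⇒¬2∣gcd {a} {b} (inj₂ (_ , 2∤b)) 2∣g = 2∤b (∣-trans 2∣g (gcd[m,n]∣n a b))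

exactlyOneOdd⇒¬2∣sum-of-squares : ExactlyOneOdd a b → ¬ 2 ∣ a ^ 2 + b ^ 2
exactlyOneOdd⇒¬2∣sum-of-squares {a} {b} (inj₁ (2∤a , 2∣b)) 2∣k =
  2∤a (prime∣m^n⇒∣m prime[2] 2
    (∣m+n∣m⇒∣n (subst (2 ∣_) (+-comm (a ^ 2) (b ^ 2)) 2∣k) (∣m⇒∣m*n (b ^ 1) 2∣b)))
exactlyOneOdd⇒¬2∣sum-of-squares {a} {b} (inj₂ (2∣a , 2∤b)) 2∣k =
  2∤b (prime∣m^n⇒∣m prime[2] 2 (∣m+n∣m⇒∣n 2∣k (∣m⇒∣m*n (a ^ 1) 2∣a)))

0<sum-of-squares : 0 < a → 0 < a ^ 2 + b ^ 2
0<sum-of-squares {suc a} _ = z<s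

square-of-sum : ∀ c Δ → (c + Δ) ^ 2 ≡ c ^ 2 + Δ * (2 * c + Δ)
square-of-sum = solve 2 (λ c Δ → (c :+ Δ) :^ 2 := c :^ 2 :+ Δ :* (con 2 :* c :+ Δ)) refl

factor-expansion : ∀ c Δ → Δ * (2 * c + Δ) ≡ c * (2 * Δ) + Δ ^ 2
factor-expansion = solve 2 (λ c Δ → Δ :* (con 2 :* c :+ Δ) := c :* (con 2 :* Δ) :+ Δ :^ 2) refl

pythagorean⇒factored : ∀ c Δ → k + c ^ 2 ≡ (c + Δ) ^ 2 → k ≡ Δ * (2 * c + Δ)
pythagorean⇒factored {k} c Δ pyth =
  +-cancelˡ-≡ (c ^ 2) k _ (trans (+-comm (c ^ 2) k) (trans pyth (square-of-sum c Δ)))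

factored⇒pythagorean : ∀ c Δ → k ≡ Δ * (2 * c + Δ) → k + c ^ 2 ≡ (c + Δ) ^ 2
factored⇒pythagorean {k} c Δ k≡ = begin
  k + c ^ 2                   ≡⟨ cong (_+ c ^ 2) k≡ ⟩
  Δ * (2 * c + Δ) + c ^ 2     ≡⟨ +-comm _ (c ^ 2) ⟩
  c ^ 2 + Δ * (2 * c + Δ)     ≡⟨ square-of-sum c Δ ⟨
  (c + Δ) ^ 2                 ∎

-- The paper's c = (k − Δ²)/(2Δ) is kept in this division-free "quotient" form; since ∸ truncates,
-- recovering the factored form from it needs Δ² < k.
factored⇒quotient : ∀ c Δ → k ≡ Δ * (2 * c + Δ) → c * (2 * Δ) ≡ k ∸ Δ ^ 2
factored⇒quotient {k} c Δ k≡ = sym (begin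
  k ∸ Δ ^ 2                       ≡⟨ cong (_∸ Δ ^ 2) (trans k≡ (factor-expansion c Δ)) ⟩
  c * (2 * Δ) + Δ ^ 2 ∸ Δ ^ 2     ≡⟨ m+n∸n≡m (c * (2 * Δ)) (Δ ^ 2) ⟩
  c * (2 * Δ)                     ∎)

quotient⇒factored : ∀ c Δ → Δ ^ 2 < k → c * (2 * Δ) ≡ k ∸ Δ ^ 2 → k ≡ Δ * (2 * c + Δ)
quotient⇒factored {k} c Δ Δ²<k quotient = begin
  k                       ≡⟨ m∸n+n≡m (<⇒≤ Δ²<k) ⟨
  k ∸ Δ ^ 2 + Δ ^ 2       ≡⟨ cong (_+ Δ ^ 2) quotient ⟨
  c * (2 * Δ) + Δ ^ 2     ≡⟨ factor-expansion c Δ ⟨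
  Δ * (2 * c + Δ)         ∎

factored⇒Δ²<k : ∀ c Δ → 0 < c → 0 < Δ → k ≡ Δ * (2 * c + Δ) → Δ ^ 2 < k
factored⇒Δ²<k {k} c Δ 0<c 0<Δ k≡ =
  subst (Δ ^ 2 <_) (sym (trans k≡ (factor-expansion c Δ)))
    (m<n+m (Δ ^ 2) (*-mono-< 0<c (*-mono-< (z<s {1}) 0<Δ)))

odd-divisor-parametrisation : ¬ 2 ∣ k → Δ ∣ k → Δ ^ 2 < k → ∃[ c ] 0 < c × k ≡ Δ * (2 * c + Δ)
odd-divisor-parametrisation {k} {Δ} 2∤k (divides q k≡q*Δ) Δ²<k =
  let c , 0<c , q≡2c+Δ = odd-gap 2∤Δ 2∤q Δ<q in c , 0<c , trans k≡Δ*q (cong (Δ *_) q≡2c+Δ)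
  where
  k≡Δ*q : k ≡ Δ * q
  k≡Δ*q = trans k≡q*Δ (*-comm q Δ)
  2∤Δ : ¬ 2 ∣ Δ
  2∤Δ 2∣Δ = 2∤k (subst (2 ∣_) (sym k≡Δ*q) (∣m⇒∣m*n q 2∣Δ))
  2∤q : ¬ 2 ∣ q
  2∤q 2∣q = 2∤k (subst (2 ∣_) (sym k≡Δ*q) (∣n⇒∣m*n Δ 2∣q))
  Δ<q : Δ < q
  Δ<q = *-cancelˡ-< Δ Δ q (subst₂ _<_ (cong (Δ *_) (*-identityʳ Δ)) k≡Δ*q Δ²<k)

gcd≡1⇒coprime-at-primes : ¬ 2 ∣ gcd a b → gcd (gcd (gcd a b) c) (c + Δ) ≡ 1 →
  CoprimeAtPrimesOf (gcd a b) Δ (2 * c + Δ)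
gcd≡1⇒coprime-at-primes {a} {b} {c} {Δ} 2∤g gcd≡1 {p} pp p∣g p∣Δ p∣2c+Δ
  with euclidsLemma 2 c pp (∣m+n∣m⇒∣n (subst (p ∣_) (+-comm (2 * c) Δ) p∣2c+Δ) p∣Δ)
... | inj₁ p∣2 = 2∤g (subst (_∣ gcd a b) (prime∣prime⇒≡ pp prime[2] p∣2) p∣g)
... | inj₂ p∣c =
  prime∤1 pp (subst (p ∣_) gcd≡1 (gcd-greatest (gcd-greatest p∣g p∣c) (∣m∣n⇒∣m+n p∣c p∣Δ)))

coprime-at-primes⇒gcd≡1 : 0 < a → CoprimeAtPrimesOf (gcd a b) Δ (2 * c + Δ) →
  gcd (gcd (gcd a b) c) (c + Δ) ≡ 1
coprime-at-primes⇒gcd≡1 {a} {b} {Δ} {c} 0<a coprime = no-prime-divisor⇒≡1 h≢0 no-prime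
  where
  h = gcd (gcd (gcd a b) c) (c + Δ)
  h∣g : h ∣ gcd a b
  h∣g = ∣-trans (gcd[m,n]∣m (gcd (gcd a b) c) (c + Δ)) (gcd[m,n]∣m (gcd a b) c)
  h∣c : h ∣ c
  h∣c = ∣-trans (gcd[m,n]∣m (gcd (gcd a b) c) (c + Δ)) (gcd[m,n]∣n (gcd a b) c)
  h∣Δ : h ∣ Δ
  h∣Δ = ∣m+n∣m⇒∣n (gcd[m,n]∣n (gcd (gcd a b) c) (c + Δ)) h∣c
  h≢0 : h ≢ 0
  h≢0 h≡0 = <-irrefl (sym (0∣⇒≡0 (subst (_∣ a) h≡0 (∣-trans h∣g (gcd[m,n]∣m a b))))) 0<a
  no-prime : ∀ {p} → Prime p → ¬ p ∣ h
  no-prime pp p∣h = coprime pp (∣-trans p∣h h∣g) (∣-trans p∣h h∣Δ)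
    (∣m∣n⇒∣m+n (∣n⇒∣m*n 2 (∣-trans p∣h h∣c)) (∣-trans p∣h h∣Δ))

PrimitiveQuadrupleWithDifference : ℕ → ℕ → ℕ → Set
PrimitiveQuadrupleWithDifference a b Δ = Σ ℕ λ c →
  0 < c × c * (2 * Δ) ≡ (a ^ 2 + b ^ 2) ∸ Δ ^ 2 × Δ ^ 2 < a ^ 2 + b ^ 2
    × IsPrimitivePythQuad a b c (c + Δ)

DifferenceConditions : ℕ → ℕ → ℕ → Set
DifferenceConditions a b Δ = Δ ∣ a ^ 2 + b ^ 2 × Δ ^ 2 < a ^ 2 + b ^ 2 × Cond3 a b Δ (a ^ 2 + b ^ 2)

quadruple⇒conditions : ExactlyOneOdd a b →
  PrimitiveQuadrupleWithDifference a b Δ → DifferenceConditions a b Δ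
quadruple⇒conditions {a} {b} {Δ} eo (c , _ , quotient , Δ²<k , _ , gcd≡1) =
  subst (Δ ∣_) (sym k≡) (m∣m*n (2 * c + Δ)) , Δ²<k ,
  subst (Cond3 a b Δ) (sym k≡) (coprime-at-primes⇒cond3 {a} {b} {m = 2 * c + Δ}
    (gcd≡1⇒coprime-at-primes {a} {b} {c} {Δ} (exactlyOneOdd⇒¬2∣gcd eo) gcd≡1))
  where
  k≡ : a ^ 2 + b ^ 2 ≡ Δ * (2 * c + Δ)
  k≡ = quotient⇒factored c Δ Δ²<k quotient

conditions⇒quadruple : 0 < a → 0 < b → ExactlyOneOdd a b → 0 < Δ →
  DifferenceConditions a b Δ → PrimitiveQuadrupleWithDifference a b Δ
conditions⇒quadruple {a} {b} {Δ} 0<a 0<b eo 0<Δ (Δ∣k , Δ²<k , cond3)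
  with odd-divisor-parametrisation (exactlyOneOdd⇒¬2∣sum-of-squares eo) Δ∣k Δ²<k
... | c , 0<c , k≡ =
  c , 0<c , factored⇒quotient c Δ k≡ , Δ²<k ,
  (0<a , 0<b , 0<c , <-≤-trans 0<c (m≤m+n c Δ) , factored⇒pythagorean c Δ k≡) ,
  coprime-at-primes⇒gcd≡1 0<a
    (cond3⇒coprime-at-primes {a = a} {b = b} 0<Δ (<-≤-trans 0<Δ (m≤n+m Δ (2 * c)))
      (subst (Cond3 a b Δ) k≡ cond3))

pythagorean-difference : IsPythQuad a b c d →
  c < d × d ≡ c + (d ∸ c)
    × c * (2 * (d ∸ c)) ≡ (a ^ 2 + b ^ 2) ∸ (d ∸ c) ^ 2 × (d ∸ c) ^ 2 < a ^ 2 + b ^ 2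
pythagorean-difference {a} {b} {c} {d} (0<a , _ , 0<c , _ , pyth) =
  c<d , d≡c+Δ , factored⇒quotient c (d ∸ c) k≡ , factored⇒Δ²<k c (d ∸ c) 0<c (m<n⇒0<n∸m c<d) k≡
  where
  c²<d² : c ^ 2 < d ^ 2
  c²<d² = subst (c ^ 2 <_) pyth (m<n+m (c ^ 2) (0<sum-of-squares {b = b} 0<a))
  c<d : c < d
  c<d = ≰⇒> λ d≤c → <⇒≱ c²<d² (^-monoˡ-≤ 2 d≤c)
  d≡c+Δ : d ≡ c + (d ∸ c)
  d≡c+Δ = sym (m+[n∸m]≡n (<⇒≤ c<d))
  k≡ : a ^ 2 + b ^ 2 ≡ (d ∸ c) * (2 * c + (d ∸ c))
  k≡ = pythagorean⇒factored c (d ∸ c) (trans pyth (cong (_^ 2) d≡c+Δ))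

mainTheorem4 : (a b : ℕ) → 0 < a → 0 < b → ExactlyOneOdd a b →
    ((Δ : ℕ) → 0 < Δ →
      ((Σ ℕ λ c → 0 < c × c * (2 * Δ) ≡ (a ^ 2 + b ^ 2) ∸ Δ ^ 2 × Δ ^ 2 < a ^ 2 + b ^ 2
          × IsPrimitivePythQuad a b c (c + Δ))
        ⇔ (Δ ∣ a ^ 2 + b ^ 2 × Δ ^ 2 < a ^ 2 + b ^ 2 × Cond3 a b Δ (a ^ 2 + b ^ 2))))
    × ((c d : ℕ) → IsPrimitivePythQuad a b c d →
        c < d × d ≡ c + (d ∸ c)
          × c * (2 * (d ∸ c)) ≡ (a ^ 2 + b ^ 2) ∸ (d ∸ c) ^ 2
          × (d ∸ c) ^ 2 < a ^ 2 + b ^ 2)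
mainTheorem4 a b 0<a 0<b eo =
  (λ Δ 0<Δ → mk⇔ (quadruple⇒conditions eo) (conditions⇒quadruple 0<a 0<b eo 0<Δ)) ,
  λ c d → pythagorean-difference ∘ proj₁
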